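{- For every positive integer $n$, writing $A_m(n)=\sum_{k=1}^n \binom{2n}{n-k}k^m$, $$\begin{aligned} A_1(n) &= \frac{n}{2}\binom{2n}{n},\\ A_3(n) &= \frac{n^2}{2}\binom{2n}{n},\\ A_5(n) &= \frac{n^2}{2}\binom{2n}{n}(2n-1),\\ A_7(n) &= \frac{n^2}{2}\binom{2n}{n}(6n^2-8n+3),\\ A_9(n) &= \frac{n^2}{2}\binom{2n}{n}(24n^3-60n^2+54n-17).\end{aligned}$$ -}

module Defs where

open import Data.Nat using (ℕ; zero; suc; _+_; _*_; _∸_; _^_)
open import Data.Nat.Combinatorics using (_C_)

sumFrom1 : ℕ → (ℕ → ℕ) → ℕ
sumFrom1 zero    f = 0
sumFrom1 (suc n) f = sumFrom1 n f + f (suc n)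

A : ℕ → ℕ → ℕ
A m n = sumFrom1 n (λ k → ((2 * n) C (n ∸ k)) * k ^ m)

-- For 0 ≤ k < n the identity (n² − k²)·C(2n, n−k) = 2n(2n−1)·C(2n−2, n−1−k), a product of two
-- absorption identities, gives the recurrence n²·A_m(n) = A_{m+2}(n) + 2n(2n−1)·A_m(n−1).
-- Together with its k = 0 case n·C(2n, n) = 2(2n−1)·C(2n−2, n−1), it turns a closed form
-- 2·A_m(n) = n·C(2n, n)·P(n) into 2·A_{m+2}(n) = n·C(2n, n)·n·R(n) with
-- R(n) = n·P(n) − (n−1)·P(n−1), so all five formulas follow from the first by polynomial
-- arithmetic. The first is a telescoping sum: 2k·C(2n, n−k) = 2n·(C(2n−1, n−k) − C(2n−1, n−k−1)).
module Submission where

module ℕ-Identities where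
  open import Defs
  open import Data.Nat using (ℕ; zero; suc; _+_; _*_; _∸_; _^_; _≤_)
  open import Data.Nat.Properties
  open import Data.Nat.Combinatorics
    using (_C_; nCk+nC[k+1]≡[n+1]C[k+1]; nCk≡nC[n∸k]; nC1≡n)
  open import Data.Nat.Tactic.RingSolver using (solve-∀)
  open import Relation.Binary.PropositionalEquality
  open ≡-Reasoning

  sumFrom1-cong : ∀ n {f g : ℕ → ℕ} → (∀ {k} → k ≤ n → f k ≡ g k) →
                  sumFrom1 n f ≡ sumFrom1 n g
  sumFrom1-cong zero    f≗g = refl
  sumFrom1-cong (suc n) f≗g =
    cong₂ _+_ (sumFrom1-cong n (λ k≤n → f≗g (m≤n⇒m≤1+n k≤n))) (f≗g ≤-refl)

  sumFrom1-distrib-+ : ∀ n (f g : ℕ → ℕ) →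
                       sumFrom1 n (λ k → f k + g k) ≡ sumFrom1 n f + sumFrom1 n g
  sumFrom1-distrib-+ zero    f g = refl
  sumFrom1-distrib-+ (suc n) f g =
    trans (cong (_+ (f (suc n) + g (suc n))) (sumFrom1-distrib-+ n f g))
          (interchange (sumFrom1 n f) (sumFrom1 n g) (f (suc n)) (g (suc n)))
    where
    open import Algebra.Properties.CommutativeSemigroup +-commutativeSemigroup
      using (interchange)

  sumFrom1-*ˡ : ∀ n c (f : ℕ → ℕ) → sumFrom1 n (λ k → c * f k) ≡ c * sumFrom1 n f
  sumFrom1-*ˡ zero    c f = sym (*-zeroʳ c)
  sumFrom1-*ˡ (suc n) c f = trans (cong (_+ c * f (suc n)) (sumFrom1-*ˡ n c f))
                                  (sym (*-distribˡ-+ c (sumFrom1 n f) (f (suc n))))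

  sumFrom1-telescope : ∀ (f g : ℕ → ℕ) {p} →
                       (∀ j k → suc j + k ≡ p → f (suc k) + g j ≡ g (suc j)) →
                       ∀ j q → j + q ≡ p → sumFrom1 q f + g j ≡ g p
  sumFrom1-telescope f g step j zero    j+0≡p = cong g (trans (sym (+-identityʳ j)) j+0≡p)
  sumFrom1-telescope f g {p} step j (suc q) j+[q+1]≡p = begin
      sumFrom1 q f + f (suc q) + g j    ≡⟨ +-assoc (sumFrom1 q f) (f (suc q)) (g j) ⟩
      sumFrom1 q f + (f (suc q) + g j)  ≡⟨ cong (sumFrom1 q f +_) (step j q [j+1]+q≡p) ⟩
      sumFrom1 q f + g (suc j)          ≡⟨ sumFrom1-telescope f g step (suc j) q [j+1]+q≡p ⟩
      g p                               ∎
    where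
    [j+1]+q≡p : suc j + q ≡ p
    [j+1]+q≡p = trans (sym (+-suc j q)) j+[q+1]≡p

  [k+1]*[n+1]C[k+1]≡[n+1]*nCk : ∀ n k → suc k * (suc n C suc k) ≡ suc n * (n C k)
  [k+1]*[n+1]C[k+1]≡[n+1]*nCk zero    zero    = refl
  [k+1]*[n+1]C[k+1]≡[n+1]*nCk zero    (suc k) = *-zeroʳ (suc (suc k))
  [k+1]*[n+1]C[k+1]≡[n+1]*nCk (suc n) zero    =
    trans (+-identityʳ _) (trans (nC1≡n (suc (suc n))) (sym (*-identityʳ _)))
  [k+1]*[n+1]C[k+1]≡[n+1]*nCk (suc n) (suc k) = begin
      suc (suc k) * (suc (suc n) C suc (suc k))
    ≡⟨ cong (suc (suc k) *_) (nCk+nC[k+1]≡[n+1]C[k+1] (suc n) (suc k)) ⟨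
      suc (suc k) * (X + Y)
    ≡⟨ regroup k X Y ⟩
      suc k * X + suc (suc k) * Y + X
    ≡⟨ cong₂ (λ u v → u + v + X) ([k+1]*[n+1]C[k+1]≡[n+1]*nCk n k)
                                 ([k+1]*[n+1]C[k+1]≡[n+1]*nCk n (suc k)) ⟩
      suc n * (n C k) + suc n * (n C suc k) + X
    ≡⟨ cong (_+ X) (*-distribˡ-+ (suc n) (n C k) (n C suc k)) ⟨
      suc n * (n C k + n C suc k) + X
    ≡⟨ cong (λ u → suc n * u + X) (nCk+nC[k+1]≡[n+1]C[k+1] n k) ⟩
      suc n * X + X
    ≡⟨ +-comm (suc n * X) X ⟩
      suc (suc n) * X ∎
    where
    X = suc n C suc k
    Y = suc n C suc (suc k)
    regroup : ∀ k X Y → suc (suc k) * (X + Y) ≡ suc k * X + suc (suc k) * Y + X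
    regroup = solve-∀

  [m+n]Cm≡[m+n]Cn : ∀ m n → (m + n) C m ≡ (m + n) C n
  [m+n]Cm≡[m+n]Cn m n = trans (nCk≡nC[n∸k] (m≤m+n m n)) (cong ((m + n) C_) (m+n∸m≡n m n))

  [n+1]*[m+n+1]Cm≡[m+n+1]*[m+n]Cm : ∀ m n →
    suc n * ((m + suc n) C m) ≡ (m + suc n) * ((m + n) C m)
  [n+1]*[m+n+1]Cm≡[m+n+1]*[m+n]Cm m n = begin
      suc n * ((m + suc n) C m)
    ≡⟨ cong (suc n *_) ([m+n]Cm≡[m+n]Cn m (suc n)) ⟩
      suc n * ((m + suc n) C suc n)
    ≡⟨ cong (λ t → suc n * (t C suc n)) (+-suc m n) ⟩
      suc n * (suc (m + n) C suc n)
    ≡⟨ [k+1]*[n+1]C[k+1]≡[n+1]*nCk (m + n) n ⟩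
      suc (m + n) * ((m + n) C n)
    ≡⟨ cong₂ _*_ (+-suc m n) ([m+n]Cm≡[m+n]Cn m n) ⟨
      (m + suc n) * ((m + n) C m) ∎

  [m+1][n+1]*[m+n+2]C[m+1]≡[m+n+2][m+n+1]*[m+n]Cm : ∀ m n →
    suc m * suc n * ((suc m + suc n) C suc m) ≡ (suc m + suc n) * (m + suc n) * ((m + n) C m)
  [m+1][n+1]*[m+n+2]C[m+1]≡[m+n+2][m+n+1]*[m+n]Cm m n = begin
      suc m * suc n * X
    ≡⟨ cong (_* X) (*-comm (suc m) (suc n)) ⟩
      suc n * suc m * X
    ≡⟨ *-assoc (suc n) (suc m) X ⟩
      suc n * (suc m * X)
    ≡⟨ cong (suc n *_) ([k+1]*[n+1]C[k+1]≡[n+1]*nCk (m + suc n) m) ⟩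
      suc n * ((suc m + suc n) * ((m + suc n) C m))
    ≡⟨ x∙yz≈y∙xz (suc n) (suc m + suc n) _ ⟩
      (suc m + suc n) * (suc n * ((m + suc n) C m))
    ≡⟨ cong ((suc m + suc n) *_) ([n+1]*[m+n+1]Cm≡[m+n+1]*[m+n]Cm m n) ⟩
      (suc m + suc n) * ((m + suc n) * ((m + n) C m))
    ≡⟨ *-assoc (suc m + suc n) (m + suc n) _ ⟨
      (suc m + suc n) * (m + suc n) * ((m + n) C m) ∎
    where
    open import Algebra.Properties.CommutativeSemigroup *-commutativeSemigroup
      using (x∙yz≈y∙xz)
    X = (suc m + suc n) C suc m

  -- (n² − k²)·C(2n, n−k) = 2n(2n−1)·C(2n−2, n−1−k) for n = p + 1, indexed by a = n − 1 − k.
  n²-k²-absorption : ∀ a k {p} → a + k ≡ p →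
    suc p * suc p * ((2 * suc p) C suc a)
      ≡ k * k * ((2 * suc p) C suc a) + 2 * suc p * suc (2 * p) * ((2 * p) C a)
  n²-k²-absorption a k refl = begin
      n * n * X
    ≡⟨ cong (_* X) (square-difference a k) ⟩
      (k * k + suc a * suc b) * X
    ≡⟨ *-distribʳ-+ X (k * k) _ ⟩
      k * k * X + suc a * suc b * X
    ≡⟨ cong (λ i → k * k * X + suc a * suc b * (i C suc a)) (index-sum a k) ⟨
      k * k * X + suc a * suc b * ((suc a + suc b) C suc a)
    ≡⟨ cong (k * k * X +_) ([m+1][n+1]*[m+n+2]C[m+1]≡[m+n+2][m+n+1]*[m+n]Cm a b) ⟩
      k * k * X + (suc a + suc b) * (a + suc b) * ((a + b) C a)
    ≡⟨ cong₂ (λ c i → k * k * X + c * (i C a)) (coefficient a k) (index-sum-2 a k) ⟩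
      k * k * X + 2 * n * suc (2 * p) * ((2 * p) C a) ∎
    where
    p = a + k
    n = suc p
    b = a + k + k
    X = (2 * n) C suc a
    square-difference : ∀ a k → suc (a + k) * suc (a + k) ≡ k * k + suc a * suc (a + k + k)
    square-difference = solve-∀
    index-sum : ∀ a k → suc a + suc (a + k + k) ≡ 2 * suc (a + k)
    index-sum = solve-∀
    index-sum-2 : ∀ a k → a + (a + k + k) ≡ 2 * (a + k)
    index-sum-2 = solve-∀
    coefficient : ∀ a k →
      (suc a + suc (a + k + k)) * (a + suc (a + k + k)) ≡ 2 * suc (a + k) * suc (2 * (a + k))
    coefficient = solve-∀

  -- 2k·C(2n, n−k) + 2n·C(2n−1, n−k−1) = 2n·C(2n−1, n−k) at k + 1, for n = p + 1 and j = n − 2 − k.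
  absorption-difference : ∀ j k {p} → suc j + k ≡ p →
    2 * suc k * ((2 * suc p) C suc j) + 2 * suc p * (suc (2 * p) C j)
      ≡ 2 * suc p * (suc (2 * p) C suc j)
  absorption-difference j k refl = begin
      2 * suc k * X + N * (suc (2 * p) C j)
    ≡⟨ cong (2 * suc k * X +_) absorb-lower ⟨
      2 * suc k * X + suc j * X
    ≡⟨ *-distribʳ-+ X (2 * suc k) (suc j) ⟨
      (2 * suc k + suc j) * X
    ≡⟨ cong₂ (λ c i → c * (i C suc j)) (weight j k) (index-sum j k) ⟩
      suc b * ((suc j + suc b) C suc j)
    ≡⟨ [n+1]*[m+n+1]Cm≡[m+n+1]*[m+n]Cm (suc j) b ⟩
      (suc j + suc b) * ((suc j + b) C suc j)
    ≡⟨ cong₂ (λ c i → c * (i C suc j)) (index-sum j k) (index-sum-1 j k) ⟨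
      N * (suc (2 * p) C suc j) ∎
    where
    p = suc j + k
    N = 2 * suc p
    X = N C suc j
    b = j + 2 * suc k
    absorb-lower : suc j * X ≡ N * (suc (2 * p) C j)
    absorb-lower = subst (λ M → suc j * (M C suc j) ≡ M * (suc (2 * p) C j)) (sym (*-suc 2 p))
                         ([k+1]*[n+1]C[k+1]≡[n+1]*nCk (suc (2 * p)) j)
    weight : ∀ j k → 2 * suc k + suc j ≡ suc (j + 2 * suc k)
    weight = solve-∀
    index-sum : ∀ j k → 2 * suc (suc j + k) ≡ suc j + suc (j + 2 * suc k)
    index-sum = solve-∀
    index-sum-1 : ∀ j k → suc (2 * (suc j + k)) ≡ suc j + (j + 2 * suc k)
    index-sum-1 = solve-∀

  -- The k = n summand is split off: there p ∸ k truncates to 0, so C(2p, p ∸ k) is 1, not 0.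
  moment-recurrence : ∀ m p →
    suc p * suc p * A m (suc p) ≡ A (2 + m) (suc p) + 2 * suc p * suc (2 * p) * A m p
  moment-recurrence m p = begin
      n * n * (sumFrom1 p F + F n)
    ≡⟨ *-distribˡ-+ (n * n) (sumFrom1 p F) (F n) ⟩
      n * n * sumFrom1 p F + n * n * F n
    ≡⟨ cong₂ _+_ (sumFrom1-*ˡ p (n * n) F) (sym (last-term n ((2 * n) C (n ∸ n)) (n ^ m))) ⟨
      sumFrom1 p (λ k → n * n * F k) + G n
    ≡⟨ cong (_+ G n) (sumFrom1-cong p summand) ⟩
      sumFrom1 p (λ k → G k + K * H k) + G n
    ≡⟨ cong (_+ G n) (trans (sumFrom1-distrib-+ p G (λ k → K * H k))
                            (cong (sumFrom1 p G +_) (sumFrom1-*ˡ p K H))) ⟩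
      sumFrom1 p G + K * sumFrom1 p H + G n
    ≡⟨ xy∙z≈xz∙y (sumFrom1 p G) (K * sumFrom1 p H) (G n) ⟩
      sumFrom1 p G + G n + K * sumFrom1 p H ∎
    where
    open import Algebra.Properties.CommutativeSemigroup +-commutativeSemigroup
      using (xy∙z≈xz∙y)
    n = suc p
    K = 2 * n * suc (2 * p)
    F G H : ℕ → ℕ
    F k = ((2 * n) C (n ∸ k)) * k ^ m
    G k = ((2 * n) C (n ∸ k)) * k ^ (2 + m)
    H k = ((2 * p) C (p ∸ k)) * k ^ m
    last-term : ∀ n X c → n * n * (X * c) ≡ X * (n * (n * c))
    last-term = solve-∀
    summand : ∀ {k} → k ≤ p → n * n * F k ≡ G k + K * H k
    summand {k} k≤p = begin
        n * n * (X * k ^ m)           ≡⟨ *-assoc (n * n) X (k ^ m) ⟨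
        n * n * X * k ^ m             ≡⟨ cong (_* k ^ m) binomial ⟩
        (k * k * X + K * Y) * k ^ m   ≡⟨ expand k X K Y (k ^ m) ⟩
        X * k ^ (2 + m) + K * (Y * k ^ m) ∎
      where
      X = (2 * n) C (n ∸ k)
      Y = (2 * p) C (p ∸ k)
      binomial : n * n * X ≡ k * k * X + K * Y
      binomial = subst (λ i → n * n * ((2 * n) C i) ≡ k * k * ((2 * n) C i) + K * Y)
                       (sym (+-∸-assoc 1 k≤p)) (n²-k²-absorption (p ∸ k) k (m∸n+n≡m k≤p))
      expand : ∀ k X K Y c → (k * k * X + K * Y) * c ≡ X * (k * (k * c)) + K * (Y * c)
      expand = solve-∀

  central-binomial-step : ∀ p → suc p * ((2 * suc p) C suc p) ≡ 2 * suc (2 * p) * ((2 * p) C p)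
  central-binomial-step p = *-cancelˡ-≡ _ _ (suc p) (begin
      suc p * (suc p * c)             ≡⟨ *-assoc (suc p) (suc p) c ⟨
      suc p * suc p * c               ≡⟨ n²-k²-absorption p 0 (+-identityʳ p) ⟩
      2 * suc p * suc (2 * p) * c′    ≡⟨ regroup (suc p) (suc (2 * p)) c′ ⟩
      suc p * (2 * suc (2 * p) * c′)  ∎)
    where
    c = (2 * suc p) C suc p
    c′ = (2 * p) C p
    regroup : ∀ n M c → 2 * n * M * c ≡ n * (2 * M * c)
    regroup = solve-∀

  first-moment : ∀ n → 2 * A 1 n ≡ n * ((2 * n) C n)
  first-moment zero    = refl
  first-moment (suc p) = begin
      2 * (sumFrom1 p f + f n)
    ≡⟨ *-distribˡ-+ 2 (sumFrom1 p f) (f n) ⟩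
      2 * sumFrom1 p f + 2 * f n
    ≡⟨ cong₂ _+_ (sumFrom1-*ˡ p 2 f) (sym last-term) ⟨
      sumFrom1 p (λ k → 2 * f k) + T 0
    ≡⟨ sumFrom1-telescope (λ k → 2 * f k) T step 0 p refl ⟩
      2 * n * (suc (2 * p) C p)
    ≡⟨ cong (_* (suc (2 * p) C p)) (*-suc 2 p) ⟩
      suc (suc (2 * p)) * (suc (2 * p) C p)
    ≡⟨ [k+1]*[n+1]C[k+1]≡[n+1]*nCk (suc (2 * p)) p ⟨
      n * (suc (suc (2 * p)) C n)
    ≡⟨ cong (λ i → n * (i C n)) (*-suc 2 p) ⟨
      n * ((2 * n) C n) ∎
    where
    n = suc p
    f T : ℕ → ℕ
    f k = ((2 * n) C (n ∸ k)) * k ^ 1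
    T j = 2 * n * (suc (2 * p) C j)
    last-term : 2 * f n ≡ T 0
    last-term = trans (cong (λ i → 2 * (((2 * n) C i) * (n * 1))) (n∸n≡0 p)) (unit-weight n)
      where
      unit-weight : ∀ n → 2 * (1 * (n * 1)) ≡ 2 * n * 1
      unit-weight = solve-∀
    step : ∀ j k → suc j + k ≡ p → 2 * f (suc k) + T j ≡ T (suc j)
    step j k [j+1]+k≡p = begin
        2 * (((2 * n) C (p ∸ k)) * (suc k * 1)) + T j
      ≡⟨ cong (λ i → 2 * (((2 * n) C i) * (suc k * 1)) + T j) p∸k≡j+1 ⟩
        2 * (((2 * n) C suc j) * (suc k * 1)) + T j
      ≡⟨ cong (_+ T j) (reweight ((2 * n) C suc j) k) ⟩
        2 * suc k * ((2 * n) C suc j) + T j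
      ≡⟨ absorption-difference j k [j+1]+k≡p ⟩
        T (suc j) ∎
      where
      p∸k≡j+1 : p ∸ k ≡ suc j
      p∸k≡j+1 = trans (cong (_∸ k) (sym [j+1]+k≡p)) (m+n∸n≡m (suc j) k)
      reweight : ∀ X k → 2 * (X * (suc k * 1)) ≡ 2 * suc k * X
      reweight = solve-∀

open import Defs
open import Data.Nat using (ℕ; zero; suc; NonZero) renaming (_+_ to _+ℕ_; _*_ to _*ℕ_)
open import Data.Nat.Combinatorics using (_C_)
open import Data.Integer using (ℤ; +_; _*_; _+_; _-_)
open import Data.Integer.Properties using (pos-*; *-identityʳ)
open import Data.Integer.Tactic.RingSolver using (solve-∀)
open import Data.Product using (_×_; _,_)
open import Relation.Binary.PropositionalEquality
  using (_≡_; refl; sym; trans; cong; cong₂; module ≡-Reasoning)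
open ℕ-Identities using (moment-recurrence; central-binomial-step; first-moment)

central : ℕ → ℕ
central n = (2 *ℕ n) C n

MomentFormula : ℕ → (ℤ → ℤ) → Set
MomentFormula m P = ∀ n → + 2 * + A m n ≡ + n * + central n * P (+ n)

pos-*-* : ∀ x y z → + (x *ℕ y *ℕ z) ≡ + x * + y * + z
pos-*-* x y z = trans (pos-* (x *ℕ y) z) (cong (_* + z) (pos-* x y))

moment-step-algebra : ∀ (N x M c c′ a a′ b P P′ : ℤ) →
  N * N * a ≡ b + + 2 * N * M * a′ → N * c ≡ + 2 * M * c′ →
  + 2 * a ≡ N * c * P → + 2 * a′ ≡ x * c′ * P′ →
  + 2 * b ≡ N * c * (N * (N * P - x * P′))
moment-step-algebra N x M c c′ a a′ b P P′ recurrence central-step formula formula′ = begin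
    + 2 * b
  ≡⟨ isolate b (+ 2 * N * M * a′) ⟩
    + 2 * (b + + 2 * N * M * a′) - + 2 * (+ 2 * N * M * a′)
  ≡⟨ cong (λ t → + 2 * t - + 2 * (+ 2 * N * M * a′)) recurrence ⟨
    + 2 * (N * N * a) - + 2 * (+ 2 * N * M * a′)
  ≡⟨ regroup₁ N M a a′ ⟩
    N * N * (+ 2 * a) - N * (+ 2 * M) * (+ 2 * a′)
  ≡⟨ cong₂ (λ u v → N * N * u - N * (+ 2 * M) * v) formula formula′ ⟩
    N * N * (N * c * P) - N * (+ 2 * M) * (x * c′ * P′)
  ≡⟨ regroup₂ N M x c c′ P P′ ⟩
    N * N * (N * c * P) - N * x * P′ * (+ 2 * M * c′)
  ≡⟨ cong (λ u → N * N * (N * c * P) - N * x * P′ * u) central-step ⟨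
    N * N * (N * c * P) - N * x * P′ * (N * c)
  ≡⟨ regroup₃ N x c P P′ ⟩
    N * c * (N * (N * P - x * P′)) ∎
  where
  open ≡-Reasoning
  isolate : ∀ b t → + 2 * b ≡ + 2 * (b + t) - + 2 * t
  isolate = solve-∀
  regroup₁ : ∀ N M a a′ → + 2 * (N * N * a) - + 2 * (+ 2 * N * M * a′)
                          ≡ N * N * (+ 2 * a) - N * (+ 2 * M) * (+ 2 * a′)
  regroup₁ = solve-∀
  regroup₂ : ∀ N M x c c′ P P′ → N * N * (N * c * P) - N * (+ 2 * M) * (x * c′ * P′)
                                 ≡ N * N * (N * c * P) - N * x * P′ * (+ 2 * M * c′)
  regroup₂ = solve-∀
  regroup₃ : ∀ N x c P P′ → N * N * (N * c * P) - N * x * P′ * (N * c)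
                            ≡ N * c * (N * (N * P - x * P′))
  regroup₃ = solve-∀

-- The shift is written + 1 + x because at x = + p it reduces to + suc p.
odd-moment-step : ∀ m (P R : ℤ → ℤ) → MomentFormula m P →
                  (∀ x → (+ 1 + x) * P (+ 1 + x) - x * P x ≡ R (+ 1 + x)) →
                  MomentFormula (2 +ℕ m) (λ x → x * R x)
odd-moment-step m P R formula difference zero    = refl
odd-moment-step m P R formula difference (suc p) =
  trans (moment-step-algebra (+ n) (+ p) (+ M) (+ central n) (+ central p)
                             (+ A m n) (+ A m p) (+ A (2 +ℕ m) n) (P (+ n)) (P (+ p))
                             recurrence central-step (formula n) (formula p))
        (cong (λ t → + n * + central n * (+ n * t)) (difference (+ p)))
  where
  n = suc p
  M = suc (2 *ℕ p)
  recurrence : + n * + n * + A m n ≡ + A (2 +ℕ m) n + + 2 * + n * + M * + A m p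
  recurrence = trans (sym (pos-*-* n n (A m n)))
    (trans (cong +_ (moment-recurrence m p))
           (cong (λ t → + A (2 +ℕ m) n + t)
                 (trans (pos-* (2 *ℕ n *ℕ M) (A m p)) (cong (_* + A m p) (pos-*-* 2 n M)))))
  central-step : + n * + central n ≡ + 2 * + M * + central p
  central-step = trans (sym (pos-* n (central n)))
                       (trans (cong +_ (central-binomial-step p)) (pos-*-* 2 M (central p)))

moment-formula₁ : MomentFormula 1 (λ _ → + 1)
moment-formula₁ n = trans (sym (pos-* 2 (A 1 n)))
  (trans (cong +_ (first-moment n)) (trans (pos-* n (central n)) (sym (*-identityʳ _))))

moment-formula₃ : MomentFormula 3 (λ x → x * + 1)
moment-formula₃ = odd-moment-step 1 (λ _ → + 1) (λ _ → + 1) moment-formula₁ solve-∀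

moment-formula₅ : MomentFormula 5 (λ x → x * (+ 2 * x - + 1))
moment-formula₅ = odd-moment-step 3 (λ x → x * + 1) (λ x → + 2 * x - + 1) moment-formula₃ solve-∀

moment-formula₇ : MomentFormula 7 (λ x → x * (+ 6 * x * x - + 8 * x + + 3))
moment-formula₇ = odd-moment-step 5 (λ x → x * (+ 2 * x - + 1))
                                    (λ x → + 6 * x * x - + 8 * x + + 3)
                                    moment-formula₅ solve-∀

moment-formula₉ : MomentFormula 9 (λ x → x * (+ 24 * x * x * x - + 60 * x * x + + 54 * x - + 17))
moment-formula₉ = odd-moment-step 7 (λ x → x * (+ 6 * x * x - + 8 * x + + 3))
                                    (λ x → + 24 * x * x * x - + 60 * x * x + + 54 * x - + 17)
                                    moment-formula₇ solve-∀

corollary5 : (n : ℕ) → .{{_ : NonZero n}} →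
      ((+ 2) * (+ A 1 n) ≡ (+ n) * (+ ((2 *ℕ n) C n)))
    × ((+ 2) * (+ A 3 n) ≡ (+ n) * (+ n) * (+ ((2 *ℕ n) C n)))
    × ((+ 2) * (+ A 5 n) ≡ (+ n) * (+ n) * (+ ((2 *ℕ n) C n)) * ((+ 2) * (+ n) - (+ 1)))
    × ((+ 2) * (+ A 7 n) ≡ (+ n) * (+ n) * (+ ((2 *ℕ n) C n))
          * ((+ 6) * (+ n) * (+ n) - (+ 8) * (+ n) + (+ 3)))
    × ((+ 2) * (+ A 9 n) ≡ (+ n) * (+ n) * (+ ((2 *ℕ n) C n))
          * ((+ 24) * (+ n) * (+ n) * (+ n) - (+ 60) * (+ n) * (+ n) + (+ 54) * (+ n) - (+ 17)))
corollary5 n =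
    trans (moment-formula₁ n) (*-identityʳ _)
  , trans (moment-formula₃ n) (reshape₃ (+ n) (+ central n))
  , trans (moment-formula₅ n) (reshape (+ n) (+ central n) _)
  , trans (moment-formula₇ n) (reshape (+ n) (+ central n) _)
  , trans (moment-formula₉ n) (reshape (+ n) (+ central n) _)
  where
  reshape₃ : ∀ N c → N * c * (N * + 1) ≡ N * N * c
  reshape₃ = solve-∀
  reshape : ∀ N c r → N * c * (N * r) ≡ N * N * c * r
  reshape = solve-∀
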